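{- Let $G(V,E)$ be a graph with $m\ge 1$ edges. Sample an edge of $G$ uniformly at random and let $u_1$ be its endpoint that is smaller with respect to $\prec$; set $d^* := d_{u_1}$ and $t:=\lceil d^*/\sqrt{m}\rceil$. Then $\mathbb{E}[t]=O(1)$, i.e., $\mathbb{E}[t]$ is bounded by an absolute constant independent of $G$.
   Context: $d_v$ denotes the degree of vertex $v$ in $G$. The total order $\prec$ on $V$ is defined by $u\prec v$ iff $d_u<d_v$, or $d_u=d_v$ and $u$ precedes $v$ in a fixed lexicographic order. (In the paper this quantity $t$ is the number of neighbor samples taken by the odd-cycle sampler, whose first sampled directed edge $(u_1,v_1)$ is a uniformly random edge oriented so that $u_1\prec v_1$.) -}

module Defs where

open import Data.Nat using (ℕ; zero; suc; _+_; _*_; _≤_; _<_; _≤ᵇ_; _<ᵇ_)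
open import Data.Fin using (Fin; toℕ) renaming (zero to fzero; suc to fsuc)
open import Data.Bool using (Bool; true; false; if_then_else_; _∧_)
open import Relation.Binary.PropositionalEquality using (_≡_)

sumFin : (n : ℕ) → (Fin n → ℕ) → ℕ
sumFin zero    f = 0
sumFin (suc n) f = f fzero + sumFin n (λ i → f (fsuc i))

record Graph : Set where
  field
    n      : ℕ
    adj    : Fin n → Fin n → Bool
    symm   : ∀ u v → adj u v ≡ adj v u
    irrefl : ∀ v → adj v v ≡ false
open Graph public

deg : (G : Graph) → Fin (n G) → ℕ
deg G v = sumFin (n G) (λ w → if adj G v w then 1 else 0)

-- sum of f u v over all edges {u,v} of G, each edge counted once
-- (as the ordered pair with toℕ u < toℕ v)
sumEdges : (G : Graph) → (Fin (n G) → Fin (n G) → ℕ) → ℕ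
sumEdges G f =
  sumFin (n G) (λ u → sumFin (n G) (λ v →
    if (toℕ u <ᵇ toℕ v) ∧ adj G u v then f u v else 0))

numEdges : Graph → ℕ
numEdges G = sumEdges G (λ _ _ → 1)

-- u ≺ v  iff  d_u < d_v, or d_u = d_v and u precedes v in the fixed
-- (index) order on Fin n.  Boolean version.
precᵇ : (G : Graph) → Fin (n G) → Fin (n G) → Bool
precᵇ G u v =
  if deg G u <ᵇ deg G v then true
  else (if deg G v <ᵇ deg G u then false else (toℕ u <ᵇ toℕ v))

minPrec : (G : Graph) → Fin (n G) → Fin (n G) → Fin (n G)
minPrec G u v = if precᵇ G u v then u else v

-- ceilSqrtDiv d m = ⌈ d / √m ⌉, i.e. the least k ∈ ℕ with k·√m ≥ d,
-- equivalently (both sides nonnegative) the least k with d·d ≤ m·k·k.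
-- Computed by linear search from 0 with fuel d+1 (for m ≥ 1 the answer is ≤ d).
searchCeil : ℕ → ℕ → ℕ → ℕ → ℕ
searchCeil d m zero       k = k
searchCeil d m (suc fuel) k =
  if d * d ≤ᵇ m * k * k then k else searchCeil d m fuel (suc k)

ceilSqrtDiv : ℕ → ℕ → ℕ
ceilSqrtDiv d m = searchCeil d m (suc d) 0

tEdge : (G : Graph) → Fin (n G) → Fin (n G) → ℕ
tEdge G u v = ceilSqrtDiv (deg G (minPrec G u v)) (numEdges G)

module Submission where

-- Let s = ⌊√m⌋ ≥ 1 and call a vertex heavy if its degree exceeds s.  Since
-- s ≤ √m we have s·⌈d/√m⌉ ≤ s + d.  For an edge with d = d_{u₁} ≤ s this is
-- at most 2s.  If d > s then both endpoints are heavy (u₁ has the smaller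
-- degree) and s + d ≤ 2s + d_u.  Summing over ordered adjacent pairs (u,v):
--
--     s · Σ t  ≤  2s · Σ_u d_u  +  H · W,
--
-- where H is the number of heavy vertices and W the sum of their degrees.
-- By the handshake bound Σ_u d_u ≤ 2m, and (s+1)·H ≤ W ≤ 2m < 2(s+1)², so
-- H ≤ 2s+1 ≤ 3s.  Hence s · Σ t ≤ 4sm + 6sm and Σ t ≤ 10m.

open import Defs
open import Data.Nat using (ℕ; zero; suc; _+_; _*_; _≤_; _<_; _≤ᵇ_; _<ᵇ_; z≤n; s≤s; pred; _≤?_; _<?_)
open import Data.Nat.Properties
open import Data.Fin using (Fin; toℕ) renaming (zero to fzero; suc to fsuc)
open import Data.Fin.Properties using (toℕ-injective)
open import Data.Bool using (true; false; if_then_else_; _∧_; T)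
open import Data.Unit using (tt)
open import Data.Empty using (⊥-elim)
open import Data.Sum using (_⊎_; inj₁; inj₂)
open import Data.Product using (∃-syntax; _×_; _,_; proj₁; proj₂)
open import Relation.Nullary using (Dec; yes; no)
open import Relation.Binary.PropositionalEquality
open import Data.Nat.Solver using (module +-*-Solver)
open +-*-Solver using (solve; _:+_; _:*_; _:=_; con)

sum-mono : ∀ n {f g : Fin n → ℕ} → (∀ i → f i ≤ g i) → sumFin n f ≤ sumFin n g
sum-mono zero    f≤g = z≤n
sum-mono (suc n) f≤g = +-mono-≤ (f≤g fzero) (sum-mono n (λ i → f≤g (fsuc i)))

sum-cong : ∀ n {f g : Fin n → ℕ} → (∀ i → f i ≡ g i) → sumFin n f ≡ sumFin n g
sum-cong zero    f≡g = refl
sum-cong (suc n) f≡g = cong₂ _+_ (f≡g fzero) (sum-cong n (λ i → f≡g (fsuc i)))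

sum-+ : ∀ n (f g : Fin n → ℕ) → sumFin n (λ i → f i + g i) ≡ sumFin n f + sumFin n g
sum-+ zero    f g = refl
sum-+ (suc n) f g rewrite sum-+ n (λ i → f (fsuc i)) (λ i → g (fsuc i)) =
  +-+-comm (f fzero) (g fzero) (sumFin n (λ i → f (fsuc i))) (sumFin n (λ i → g (fsuc i)))
  where
  +-+-comm : ∀ a b c d → (a + b) + (c + d) ≡ (a + c) + (b + d)
  +-+-comm = solve 4 (λ a b c d → (a :+ b) :+ (c :+ d) := (a :+ c) :+ (b :+ d)) refl

sum-* : ∀ n c (f : Fin n → ℕ) → sumFin n (λ i → c * f i) ≡ c * sumFin n f
sum-* zero    c f = sym (*-zeroʳ c)
sum-* (suc n) c f rewrite sum-* n c (λ i → f (fsuc i)) = sym (*-distribˡ-+ c (f fzero) _)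

sum-zero : ∀ n → sumFin n (λ _ → 0) ≡ 0
sum-zero zero    = refl
sum-zero (suc n) = sum-zero n

sum-swap : ∀ n k (f : Fin n → Fin k → ℕ) →
  sumFin n (λ u → sumFin k (f u)) ≡ sumFin k (λ v → sumFin n (λ u → f u v))
sum-swap zero    k f = sym (sum-zero k)
sum-swap (suc n) k f rewrite sum-swap n k (λ u → f (fsuc u)) =
  sym (sum-+ k (f fzero) (λ v → sumFin n (λ u → f (fsuc u) v)))

sum-product : ∀ n k (f : Fin n → ℕ) (g : Fin k → ℕ) →
  sumFin n (λ u → sumFin k (λ v → f u * g v)) ≡ sumFin n f * sumFin k g
sum-product n k f g = begin
  sumFin n (λ u → sumFin k (λ v → f u * g v)) ≡⟨ sum-cong n (λ u → sum-* k (f u) g) ⟩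
  sumFin n (λ u → f u * sumFin k g)           ≡⟨ sum-cong n (λ u → *-comm (f u) _) ⟩
  sumFin n (λ u → sumFin k g * f u)           ≡⟨ sum-* n (sumFin k g) f ⟩
  sumFin k g * sumFin n f                     ≡⟨ *-comm (sumFin k g) _ ⟩
  sumFin n f * sumFin k g                     ∎
  where open ≡-Reasoning

<ᵇ-true⇒< : ∀ {x y} → (x <ᵇ y) ≡ true → x < y
<ᵇ-true⇒< {x} {y} eq = <ᵇ⇒< x y (subst T (sym eq) tt)

<ᵇ-false⇒≥ : ∀ {x y} → (x <ᵇ y) ≡ false → y ≤ x
<ᵇ-false⇒≥ eq = ≮⇒≥ (λ lt → subst T eq (<⇒<ᵇ lt))

≤ᵇ-false⇒> : ∀ {x y} → (x ≤ᵇ y) ≡ false → y < x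
≤ᵇ-false⇒> eq = ≰⇒> (λ le → subst T eq (≤⇒≤ᵇ le))

square-<⇒< : ∀ x y → x * x < y * y → x < y
square-<⇒< x y x²<y² with x <? y
... | yes x<y = x<y
... | no  x≮y = ⊥-elim (<⇒≱ x²<y² (*-mono-≤ (≮⇒≥ x≮y) (≮⇒≥ x≮y)))

searchCeil-spec : ∀ d m fuel k → let r = searchCeil d m fuel k in
  r ≡ k ⊎ (d * d ≤ᵇ m * pred r * pred r) ≡ false
searchCeil-spec d m zero       k = inj₁ refl
searchCeil-spec d m (suc fuel) k with d * d ≤ᵇ m * k * k in test
... | true  = inj₁ refl
... | false with searchCeil-spec d m fuel (suc k)
...   | inj₂ failed   = inj₂ failed
...   | inj₁ returned rewrite returned = inj₂ test

-- If s ≤ √m then s·⌈d/√m⌉ ≤ s + d: one step below the ceiling, s·(r-1) < d.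
ceilSqrtDiv-bound : ∀ s m d → s * s ≤ m → s * ceilSqrtDiv d m ≤ s + d
ceilSqrtDiv-bound s m d s²≤m = bound _ (searchCeil-spec d m (suc d) 0)
  where
  open ≤-Reasoning
  bound : ∀ r → r ≡ 0 ⊎ (d * d ≤ᵇ m * pred r * pred r) ≡ false → s * r ≤ s + d
  bound zero    _             rewrite *-zeroʳ s = z≤n
  bound (suc p) (inj₁ ())
  bound (suc p) (inj₂ failed) = begin
      s * suc p ≡⟨ *-suc s p ⟩
      s + s * p ≤⟨ +-monoʳ-≤ s (<⇒≤ (square-<⇒< (s * p) d sp²<d²)) ⟩
      s + d     ∎
    where
    sp²<d² : s * p * (s * p) < d * d
    sp²<d² = begin-strict
      s * p * (s * p) ≡⟨ solve 2 (λ s p → s :* p :* (s :* p) := s :* s :* p :* p) refl s p ⟩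
      s * s * p * p   ≤⟨ *-monoˡ-≤ p (*-monoˡ-≤ p s²≤m) ⟩
      m * p * p       <⟨ ≤ᵇ-false⇒> failed ⟩
      d * d           ∎

floorSqrt : ∀ m → ∃[ s ] (s * s ≤ m × m < suc s * suc s)
floorSqrt zero    = 0 , z≤n , s≤s z≤n
floorSqrt (suc m) with floorSqrt m
... | s , s²≤m , m<[s+1]² with suc s * suc s ≤? suc m
...   | yes [s+1]²≤m+1 = suc s , [s+1]²≤m+1 ,
          ≤-<-trans m<[s+1]² (*-mono-< (n<1+n (suc s)) (n<1+n (suc s)))
...   | no  [s+1]²≰m+1 = s , m≤n⇒m≤1+n s²≤m , ≰⇒> [s+1]²≰m+1

module _ (G : Graph) where
  private
    V = n G

  onAdj : (Fin V → Fin V → ℕ) → Fin V → Fin V → ℕ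
  onAdj f u v = if adj G u v then f u v else 0

  sumPairs : (Fin V → Fin V → ℕ) → ℕ
  sumPairs f = sumFin V (λ u → sumFin V (f u))

  degreeSum : ℕ
  degreeSum = sumFin V (deg G)

  private
    once : Fin V → Fin V → ℕ
    once u v = if (toℕ u <ᵇ toℕ v) ∧ adj G u v then 1 else 0

  -- Each adjacent ordered pair is counted by one of its two orientations;
  -- u = v cannot occur since the graph is loopless.
  adj≤orientations : ∀ u v → onAdj (λ _ _ → 1) u v ≤ once u v + once v u
  adj≤orientations u v with adj G u v in uv
  ... | false = z≤n
  ... | true with toℕ u <ᵇ toℕ v in u<v
  ...   | true = s≤s z≤n
  ...   | false rewrite symm G v u | uv with toℕ v <ᵇ toℕ u in v<u
  ...     | true  = s≤s z≤n
  ...     | false with refl ← toℕ-injective {i = u} {j = v} (≤-antisym (<ᵇ-false⇒≥ v<u) (<ᵇ-false⇒≥ u<v))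
                   with () ← trans (sym (irrefl G u)) uv

  handshake : degreeSum ≤ numEdges G + numEdges G
  handshake = begin
    degreeSum
      ≤⟨ sum-mono V (λ u → sum-mono V (adj≤orientations u)) ⟩
    sumPairs (λ u v → once u v + once v u)
      ≡⟨ sum-cong V (λ u → sum-+ V (once u) (λ v → once v u)) ⟩
    sumFin V (λ u → sumFin V (once u) + sumFin V (λ v → once v u))
      ≡⟨ sum-+ V (λ u → sumFin V (once u)) (λ u → sumFin V (λ v → once v u)) ⟩
    numEdges G + sumPairs (λ u v → once v u)
      ≡⟨ cong (numEdges G +_) (sum-swap V V (λ u v → once v u)) ⟩
    numEdges G + numEdges G ∎
    where open ≤-Reasoning

  sumEdges≤sumPairs : ∀ f → sumEdges G f ≤ sumPairs (onAdj f)
  sumEdges≤sumPairs f = sum-mono V (λ u → sum-mono V (λ v →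
    drop-guard (toℕ u <ᵇ toℕ v) (adj G u v) (f u v)))
    where
    drop-guard : ∀ b a x → (if b ∧ a then x else 0) ≤ (if a then x else 0)
    drop-guard true  a     x = ≤-refl
    drop-guard false true  x = z≤n
    drop-guard false false x = z≤n

-- precᵇ compares degrees first: if u ≺ v then d_u ≤ d_v, otherwise d_v ≤ d_u.
-- (Stated for the unfolded comparison on arbitrary x, y and tie-breaker b.)
lexMin≤ : ∀ x y b → (if x <ᵇ y then true else (if y <ᵇ x then false else b)) ≡ true → x ≤ y
lexMin≤ x y b first with x <ᵇ y in x<y | y <ᵇ x in y<x
... | true  | _     = <⇒≤ (<ᵇ-true⇒< x<y)
... | false | false = <ᵇ-false⇒≥ y<x

lexMin≥ : ∀ x y b → (if x <ᵇ y then true else (if y <ᵇ x then false else b)) ≡ false → y ≤ x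
lexMin≥ x y b second with x <ᵇ y in x<y | y <ᵇ x in y<x
... | false | true  = <⇒≤ (<ᵇ-true⇒< y<x)
... | false | false = <ᵇ-false⇒≥ x<y

minPrec-deg : ∀ G u v → deg G (minPrec G u v) ≤ deg G u × deg G (minPrec G u v) ≤ deg G v
minPrec-deg G u v with precᵇ G u v in order
... | true  = ≤-refl , lexMin≤ (deg G u) (deg G v) _ order
... | false = lexMin≥ (deg G u) (deg G v) _ order , ≤-refl

module _ (G : Graph) (s : ℕ) where
  private
    V = n G

  heavy : Fin V → ℕ
  heavy u = if s <ᵇ deg G u then 1 else 0

  heavyDeg : Fin V → ℕ
  heavyDeg u = heavy u * deg G u

  heavyCount heavyDegSum : ℕ
  heavyCount  = sumFin V heavy
  heavyDegSum = sumFin V heavyDeg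

  heavy-on : ∀ u → s < deg G u → heavy u ≡ 1
  heavy-on u s<d with s <ᵇ deg G u | <⇒<ᵇ s<d
  ... | true | _ = refl

  heavyDeg≤deg : ∀ u → heavyDeg u ≤ deg G u
  heavyDeg≤deg u with s <ᵇ deg G u
  ... | true  = ≤-reflexive (+-identityʳ (deg G u))
  ... | false = z≤n

  heavy≤heavyDeg : ∀ u → suc s * heavy u ≤ heavyDeg u
  heavy≤heavyDeg u with s <ᵇ deg G u in s<d
  ... | true  rewrite *-identityʳ (suc s) | +-identityʳ (deg G u) = <ᵇ-true⇒< s<d
  ... | false rewrite *-zeroʳ s = z≤n

  pair-bound : s * s ≤ numEdges G → ∀ u v →
    s * onAdj G (tEdge G) u v ≤ onAdj G (λ _ _ → s + s) u v + heavyDeg u * heavy v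
  pair-bound s²≤m u v with adj G u v
  ... | false rewrite *-zeroʳ s = z≤n
  ... | true  = ≤-trans (ceilSqrtDiv-bound s (numEdges G) d s²≤m) (split (s <? d))
    where
    d = deg G (minPrec G u v)
    split : Dec (s < d) → s + d ≤ (s + s) + heavyDeg u * heavy v
    split (no  s≮d) = ≤-trans (+-monoʳ-≤ s (≮⇒≥ s≮d)) (m≤m+n (s + s) _)
    split (yes s<d)
      rewrite heavy-on u (<-≤-trans s<d (proj₁ (minPrec-deg G u v)))
            | heavy-on v (<-≤-trans s<d (proj₂ (minPrec-deg G u v)))
            | +-identityʳ (deg G u) | *-identityʳ (deg G u)
      = ≤-trans (+-monoʳ-≤ s (proj₁ (minPrec-deg G u v))) (+-monoˡ-≤ (deg G u) (m≤m+n s s))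

  sumPairs-const : sumPairs G (onAdj G (λ _ _ → s + s)) ≡ (s + s) * degreeSum G
  sumPairs-const = trans (sum-cong V (λ u → trans (sum-cong V (scale u)) (sum-* V (s + s) _)))
                         (sum-* V (s + s) (deg G))
    where
    scale : ∀ u v → onAdj G (λ _ _ → s + s) u v ≡ (s + s) * onAdj G (λ _ _ → 1) u v
    scale u v with adj G u v
    ... | true  = sym (*-identityʳ (s + s))
    ... | false = sym (*-zeroʳ (s + s))

  sumPairs-bound : s * s ≤ numEdges G →
    s * sumPairs G (onAdj G (tEdge G)) ≤ (s + s) * degreeSum G + heavyDegSum * heavyCount
  sumPairs-bound s²≤m = begin
    s * sumPairs G (onAdj G (tEdge G))
      ≡⟨ sym (sum-* V s _) ⟩
    sumFin V (λ u → s * sumFin V (onAdj G (tEdge G) u))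
      ≡⟨ sum-cong V (λ u → sym (sum-* V s _)) ⟩
    sumPairs G (λ u v → s * onAdj G (tEdge G) u v)
      ≤⟨ sum-mono V (λ u → sum-mono V (pair-bound s²≤m u)) ⟩
    sumPairs G (λ u v → onAdj G (λ _ _ → s + s) u v + heavyDeg u * heavy v)
      ≡⟨ sum-cong V (λ u → sum-+ V _ (λ v → heavyDeg u * heavy v)) ⟩
    sumFin V (λ u → sumFin V (onAdj G (λ _ _ → s + s) u) + sumFin V (λ v → heavyDeg u * heavy v))
      ≡⟨ sum-+ V _ _ ⟩
    sumPairs G (onAdj G (λ _ _ → s + s)) + sumPairs G (λ u v → heavyDeg u * heavy v)
      ≡⟨ cong₂ _+_ sumPairs-const (sum-product V V heavyDeg heavy) ⟩
    (s + s) * degreeSum G + heavyDegSum * heavyCount ∎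
    where open ≤-Reasoning

  heavyDegSum≤2m : heavyDegSum ≤ numEdges G + numEdges G
  heavyDegSum≤2m = ≤-trans (sum-mono V heavyDeg≤deg) (handshake G)

  -- (s+1)·H ≤ W ≤ 2m < 2(s+1)², so there are at most 2s+1 heavy vertices.
  heavyCount-bound : numEdges G < suc s * suc s → heavyCount ≤ suc (s + s)
  heavyCount-bound m<[s+1]² = ≤-pred (≤-trans H<2s+2 (≤-reflexive (cong suc (+-suc s s))))
    where
    open ≤-Reasoning
    H<2s+2 : heavyCount < suc s + suc s
    H<2s+2 = *-cancelˡ-< (suc s) heavyCount (suc s + suc s) (begin-strict
      suc s * heavyCount            ≡⟨ sym (sum-* V (suc s) heavy) ⟩
      sumFin V (λ u → suc s * heavy u) ≤⟨ sum-mono V heavy≤heavyDeg ⟩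
      heavyDegSum                   ≤⟨ heavyDegSum≤2m ⟩
      numEdges G + numEdges G       <⟨ +-mono-< m<[s+1]² m<[s+1]² ⟩
      suc s * suc s + suc s * suc s ≡⟨ sym (*-distribˡ-+ (suc s) (suc s) (suc s)) ⟩
      suc s * (suc s + suc s)       ∎)

lemma4p1 : ∃[ C ] (∀ (G : Graph) → 1 ≤ numEdges G → sumEdges G (tEdge G) ≤ C * numEdges G)
lemma4p1 = 10 , sum-t≤10m
  where
  sum-t≤10m : ∀ G → 1 ≤ numEdges G → sumEdges G (tEdge G) ≤ 10 * numEdges G
  sum-t≤10m G 1≤m with floorSqrt (numEdges G)
  ... | zero  , _    , m<1      = ⊥-elim (<⇒≱ m<1 1≤m)
  ... | suc k , s²≤m , m<[s+1]² = *-cancelˡ-≤ (suc k) (begin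
      s * sumEdges G (tEdge G)
        ≤⟨ *-monoʳ-≤ s (sumEdges≤sumPairs G (tEdge G)) ⟩
      s * sumPairs G (onAdj G (tEdge G))
        ≤⟨ sumPairs-bound G s s²≤m ⟩
      (s + s) * degreeSum G + heavyDegSum G s * heavyCount G s
        ≤⟨ +-mono-≤ (*-monoʳ-≤ (s + s) (handshake G))
                    (*-mono-≤ (heavyDegSum≤2m G s) (≤-trans (heavyCount-bound G s m<[s+1]²) 2s+1≤3s)) ⟩
      (s + s) * (m + m) + (m + m) * (s + s + s)
        ≡⟨ solve 2 (λ s m → (s :+ s) :* (m :+ m) :+ (m :+ m) :* (s :+ s :+ s) := s :* (con 10 :* m)) refl s m ⟩
      s * (10 * m) ∎)
    where
    open ≤-Reasoning
    s = suc k
    m = numEdges G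
    2s+1≤3s : suc (s + s) ≤ s + s + s
    2s+1≤3s = ≤-trans (≤-reflexive (+-comm 1 (s + s))) (+-monoʳ-≤ (s + s) (s≤s z≤n))
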